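{- Let $\phi$ be a ternary stratified formula and $\phi\to\phi'$. Then precisely one of the following holds: (a) $\mathrm{complexity}(\phi)<\mathrm{complexity}(\phi')$; (b) $\mathrm{complexity}(\phi')=\mathrm{complexity}(\phi)$ and $\mathrm{atomic}(\phi)>\mathrm{atomic}(\phi')$. The same holds for ternary stratified terms $t\to t'$.
   Context: Atoms: for each $i\in\mathbb{Z}$ a countably infinite set $\mathbb{A}_i$ of atoms, pairwise disjoint; $\mathrm{level}(a)=i$ iff $a\in\mathbb{A}_i$. Syntax: formulae $\phi,\psi::=\bot\mid\neg\phi\mid\phi\wedge\psi\mid\forall a.\phi\mid s\in t$, terms $s,t::=a\mid\{a\mid\phi\}$, binders $\forall a$ and $\{a\mid\cdot\}$, up to $\alpha$-equivalence; $\phi[a:=s]$ is capture-avoiding substitution. $\mathrm{level}(\{a\mid\phi\})=\mathrm{level}(a)+1$; only stratified syntax is considered (every subformula $s'\in s$ has $\mathrm{level}(s)=\mathrm{level}(s')+1$). $\to$ is the least relation containing $t\in\{a\mid\phi\}\to\phi[a:=t]$ and closed under contexts ($\neg$, either side of $\wedge$, $\forall a.$, $\{a\mid\cdot\}$, either side of $\in$). A comprehension $\{a\mid\phi\}$ is ternary if $a$ occurs in $\phi$ at least three times; a formula or term is ternary if every comprehension in it is ternary. Complexity: $\mathrm{complexity}(a)=1$; $\mathrm{complexity}(\{a\mid\phi\})=1+\mathrm{complexity}(\phi)$; $\mathrm{complexity}(\bot)=3$; $\mathrm{complexity}(\phi\wedge\psi)=\mathrm{complexity}(\phi)+1+\mathrm{complexity}(\psi)$;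 $\mathrm{complexity}(\neg\phi)=\mathrm{complexity}(\forall a.\phi)=1+\mathrm{complexity}(\phi)$; $\mathrm{complexity}(b\in\{a\mid\phi\})=\mathrm{complexity}(\phi)$ for $b$ an atom; $\mathrm{complexity}(t\in s)=\mathrm{complexity}(t)+1+\mathrm{complexity}(s)$ when $t$ is not an atom or $s$ is not a comprehension. Number of atomic reducts: $\mathrm{atomic}(a)=0$; $\mathrm{atomic}(\{a\mid\phi\})=\mathrm{atomic}(\phi)$; $\mathrm{atomic}(\bot)=0$; $\mathrm{atomic}(\phi\wedge\psi)=\mathrm{atomic}(\phi)+\mathrm{atomic}(\psi)$; $\mathrm{atomic}(\neg\phi)=\mathrm{atomic}(\forall a.\phi)=\mathrm{atomic}(\phi)$; $\mathrm{atomic}(t\in b)=\mathrm{atomic}(t)$ for $b$ an atom; $\mathrm{atomic}(t\in\{a\mid\phi\})=\mathrm{atomic}(\phi)+1$ when $t$ is an atom; $\mathrm{atomic}(t\in s)=\mathrm{atomic}(t)+\mathrm{atomic}(s)$ when $t$ is not an atom. -}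

module Defs where

open import Data.Nat using (ℕ; zero; suc; _+_; _≥_)
open import Data.Integer using (ℤ) renaming (suc to sucℤ)
open import Data.List using (List; []; _∷_)
open import Data.Product using (_×_)
open import Data.Unit using (⊤)
open import Relation.Binary.PropositionalEquality using (_≡_; refl)

-- Intrinsically stratified, de Bruijn (= up to α-equivalence) syntax.
-- A context Γ lists the levels of the bound atoms in scope (innermost first).
-- Free atoms of level l are  atom n  (n : ℕ), a countably infinite family per level.

data _∋_ : List ℤ → ℤ → Set where
  ze : ∀ {Γ l} → (l ∷ Γ) ∋ l
  su : ∀ {Γ l k} → Γ ∋ l → (k ∷ Γ) ∋ l

mutual
  data Term (Γ : List ℤ) : ℤ → Set where
    atom : ∀ {l} → ℕ → Term Γ l
    var  : ∀ {l} → Γ ∋ l → Term Γ l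
    comp : (k : ℤ) → Form (k ∷ Γ) → Term Γ (sucℤ k)    -- {a | φ}, level(a) = k

  data Form (Γ : List ℤ) : Set where
    ⊥'   : Form Γ
    ¬'_  : Form Γ → Form Γ
    _∧'_ : Form Γ → Form Γ → Form Γ
    ∀'   : (k : ℤ) → Form (k ∷ Γ) → Form Γ
    -- s ∈ t, with the stratification condition level(t) = level(s) + 1
    mem  : ∀ {k l} → Term Γ k → Term Γ l → sucℤ k ≡ l → Form Γ

Ren : List ℤ → List ℤ → Set
Ren Γ Δ = ∀ {l} → Γ ∋ l → Δ ∋ l

extR : ∀ {Γ Δ k} → Ren Γ Δ → Ren (k ∷ Γ) (k ∷ Δ)
extR ρ ze = ze
extR ρ (su x) = su (ρ x)

mutual
  renT : ∀ {Γ Δ l} → Ren Γ Δ → Term Γ l → Term Δ l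
  renT ρ (atom n) = atom n
  renT ρ (var x) = var (ρ x)
  renT ρ (comp k φ) = comp k (renF (extR ρ) φ)

  renF : ∀ {Γ Δ} → Ren Γ Δ → Form Γ → Form Δ
  renF ρ ⊥' = ⊥'
  renF ρ (¬' φ) = ¬' renF ρ φ
  renF ρ (φ ∧' ψ) = renF ρ φ ∧' renF ρ ψ
  renF ρ (∀' k φ) = ∀' k (renF (extR ρ) φ)
  renF ρ (mem s t p) = mem (renT ρ s) (renT ρ t) p

Sub : List ℤ → List ℤ → Set
Sub Γ Δ = ∀ {l} → Γ ∋ l → Term Δ l

extS : ∀ {Γ Δ k} → Sub Γ Δ → Sub (k ∷ Γ) (k ∷ Δ)
extS σ ze = var ze
extS σ (su x) = renT su (σ x)

mutual
  subT : ∀ {Γ Δ l} → Sub Γ Δ → Term Γ l → Term Δ l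
  subT σ (atom n) = atom n
  subT σ (var x) = σ x
  subT σ (comp k φ) = comp k (subF (extS σ) φ)

  subF : ∀ {Γ Δ} → Sub Γ Δ → Form Γ → Form Δ
  subF σ ⊥' = ⊥'
  subF σ (¬' φ) = ¬' subF σ φ
  subF σ (φ ∧' ψ) = subF σ φ ∧' subF σ ψ
  subF σ (∀' k φ) = ∀' k (subF (extS σ) φ)
  subF σ (mem s t p) = mem (subT σ s) (subT σ t) p

single : ∀ {Γ k} → Term Γ k → Sub (k ∷ Γ) Γ
single t ze = t
single t (su x) = var x

-- φ[a := t], a the innermost bound atom
_[_] : ∀ {Γ k} → Form (k ∷ Γ) → Term Γ k → Form Γ
φ [ t ] = subF (single t) φ

mutual
  data _⟶F_ {Γ : List ℤ} : Form Γ → Form Γ → Set where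
    β    : ∀ {k} (t : Term Γ k) (φ : Form (k ∷ Γ)) → mem t (comp k φ) refl ⟶F (φ [ t ])
    ξ¬   : ∀ {φ φ'} → φ ⟶F φ' → (¬' φ) ⟶F (¬' φ')
    ξ∧ˡ  : ∀ {φ φ' ψ} → φ ⟶F φ' → (φ ∧' ψ) ⟶F (φ' ∧' ψ)
    ξ∧ʳ  : ∀ {φ ψ ψ'} → ψ ⟶F ψ' → (φ ∧' ψ) ⟶F (φ ∧' ψ')
    ξ∀   : ∀ {k φ φ'} → φ ⟶F φ' → ∀' k φ ⟶F ∀' k φ'
    ξ∈ˡ  : ∀ {k l} {s s' : Term Γ k} {t : Term Γ l} {p} → s ⟶T s' → mem s t p ⟶F mem s' t p
    ξ∈ʳ  : ∀ {k l} {s : Term Γ k} {t t' : Term Γ l} {p} → t ⟶T t' → mem s t p ⟶F mem s t' p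

  data _⟶T_ {Γ : List ℤ} : ∀ {l} → Term Γ l → Term Γ l → Set where
    ξcomp : ∀ {k φ φ'} → φ ⟶F φ' → comp k φ ⟶T comp k φ'

idx : ∀ {Γ l} → Γ ∋ l → ℕ
idx ze = zero
idx (su x) = suc (idx x)

eqℕ : ℕ → ℕ → ℕ
eqℕ zero zero = 1
eqℕ zero (suc m) = 0
eqℕ (suc n) zero = 0
eqℕ (suc n) (suc m) = eqℕ n m

mutual
  occT : ∀ {Γ l} → ℕ → Term Γ l → ℕ
  occT i (atom n) = 0
  occT i (var x) = eqℕ i (idx x)
  occT i (comp k φ) = occF (suc i) φ

  occF : ∀ {Γ} → ℕ → Form Γ → ℕ
  occF i ⊥' = 0
  occF i (¬' φ) = occF i φ
  occF i (φ ∧' ψ) = occF i φ + occF i ψ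
  occF i (∀' k φ) = occF (suc i) φ
  occF i (mem s t p) = occT i s + occT i t

mutual
  TernaryT : ∀ {Γ l} → Term Γ l → Set
  TernaryT (atom n) = ⊤
  TernaryT (var x) = ⊤
  TernaryT (comp k φ) = (occF 0 φ ≥ 3) × TernaryF φ

  TernaryF : ∀ {Γ} → Form Γ → Set
  TernaryF ⊥' = ⊤
  TernaryF (¬' φ) = TernaryF φ
  TernaryF (φ ∧' ψ) = TernaryF φ × TernaryF ψ
  TernaryF (∀' k φ) = TernaryF φ
  TernaryF (mem s t p) = TernaryT s × TernaryT t

mutual
  complexityT : ∀ {Γ l} → Term Γ l → ℕ
  complexityT (atom n) = 1
  complexityT (var x) = 1
  complexityT (comp k φ) = 1 + complexityF φ

  complexityF : ∀ {Γ} → Form Γ → ℕ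
  complexityF ⊥' = 3
  complexityF (φ ∧' ψ) = complexityF φ + 1 + complexityF ψ
  complexityF (¬' φ) = 1 + complexityF φ
  complexityF (∀' k φ) = 1 + complexityF φ
  complexityF (mem (atom n) (comp k φ) p) = complexityF φ
  complexityF (mem (var x) (comp k φ) p) = complexityF φ
  complexityF (mem (atom n) (atom m) p) = 1 + 1 + 1
  complexityF (mem (atom n) (var y) p) = 1 + 1 + 1
  complexityF (mem (var x) (atom m) p) = 1 + 1 + 1
  complexityF (mem (var x) (var y) p) = 1 + 1 + 1
  complexityF (mem (comp j ψ) s p) = complexityT (comp j ψ) + 1 + complexityT s

mutual
  atomicT : ∀ {Γ l} → Term Γ l → ℕ
  atomicT (atom n) = 0
  atomicT (var x) = 0
  atomicT (comp k φ) = atomicF φ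

  atomicF : ∀ {Γ} → Form Γ → ℕ
  atomicF ⊥' = 0
  atomicF (φ ∧' ψ) = atomicF φ + atomicF ψ
  atomicF (¬' φ) = atomicF φ
  atomicF (∀' k φ) = atomicF φ
  atomicF (mem t (atom m) p) = atomicT t
  atomicF (mem t (var y) p) = atomicT t
  atomicF (mem (atom n) (comp k φ) p) = atomicF φ + 1
  atomicF (mem (var x) (comp k φ) p) = atomicF φ + 1
  atomicF (mem (comp j ψ) (comp k φ) p) = atomicT (comp j ψ) + atomicT (comp k φ)

ExactlyOne : Set → Set → Set
ExactlyOne A B = (A ⊎' B) × (A × B → Empty)
  where
    open import Data.Sum using () renaming (_⊎_ to _⊎'_)
    open import Data.Empty using () renaming (⊥ to Empty)

module Submission where

-- Write c and a for complexity and number of atomic reducts.  A step makes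
-- Progress when c strictly grows, or c is unchanged and a strictly drops; the
-- two alternatives exclude each other, so the corollary reduces to showing
-- that every step of a ternary formula or term makes Progress.
--
-- Context steps are handled by induction, since c and a are strictly
-- monotone in each immediate subformula.  The β-rule t ∈ {a | φ} ⟶ φ[a:=t]
-- splits on the argument t:
--   * t an atom: substituting atoms for atoms preserves c and a, while the
--     redex itself is one atomic reduct; so c stays and a drops by one.
--   * t = {b | ψ}: each of the ≥ 3 occurrences of a in φ (ternarity) is
--     replaced by a comprehension, which raises c by at least D = c(ψ) − 3.
--     Ternarity of ψ gives c(ψ) ≥ 7, hence
--     c(φ) + 3 (c(ψ) − 3) > c(ψ) + c(φ) + 3 = c(t ∈ {a | φ}), and c grows.

open import Defs
open import Data.Nat using (ℕ; zero; suc; _+_; _*_; _≤_; _<_; _>_; z≤n; s≤s)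
open import Data.Nat.Properties
open import Data.Nat.Tactic.RingSolver using (solve-∀)
open import Data.Integer using (ℤ) renaming (suc to sucℤ)
open import Data.List using ([]; _∷_)
open import Data.Product using (_×_; _,_; proj₁)
open import Data.Sum using (_⊎_; inj₁; inj₂)
open import Data.Empty using (⊥-elim)
open import Relation.Binary.PropositionalEquality
  using (_≡_; refl; sym; trans; cong; cong₂; subst; subst₂)

Progress : ℕ → ℕ → ℕ → ℕ → Set
Progress c a c' a' = (c < c') ⊎ ((c' ≡ c) × (a > a'))

progress⇒exactlyOne : ∀ {c a c' a'} → Progress c a c' a' →
                      ExactlyOne (c < c') ((c' ≡ c) × (a > a'))
progress⇒exactlyOne p = p , λ { (c<c' , (c'≡c , _)) → <-irrefl (sym c'≡c) c<c' }

StrictlyMonotone : (ℕ → ℕ) → Set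
StrictlyMonotone f = ∀ {x y} → x < y → f x < f y

-- Progress survives applying strictly monotone maps to both measures; this
-- carries a step of a subformula through the surrounding context.
progress-map : ∀ {c a c' a'} (f g : ℕ → ℕ) → StrictlyMonotone f → StrictlyMonotone g →
               Progress c a c' a' → Progress (f c) (g a) (f c') (g a')
progress-map f g f-mono g-mono (inj₁ c<c')          = inj₁ (f-mono c<c')
progress-map f g f-mono g-mono (inj₂ (c'≡c , a>a')) = inj₂ (cong f c'≡c , g-mono a>a')

progress-suc : ∀ {c a c' a'} → Progress c a c' a' → Progress (suc c) a (suc c') a'
progress-suc = progress-map suc (λ x → x) s≤s (λ a>a' → a>a')

data IsAtom {Γ} : ∀ {l} → Term Γ l → Set where
  free  : ∀ {l} n → IsAtom (atom {l = l} n)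
  bound : ∀ {l} (x : Γ ∋ l) → IsAtom (var x)

occ-atom≤1 : ∀ {Γ l} {t : Term Γ l} i → IsAtom t → occT i t ≤ 1
occ-atom≤1 i (free n) = z≤n
occ-atom≤1 i (bound x) = eqℕ≤1 i (idx x)
  where
  eqℕ≤1 : ∀ a b → eqℕ a b ≤ 1
  eqℕ≤1 zero    zero    = s≤s z≤n
  eqℕ≤1 zero    (suc b) = z≤n
  eqℕ≤1 (suc a) zero    = z≤n
  eqℕ≤1 (suc a) (suc b) = eqℕ≤1 a b

-- The measures of a membership whose sides have a known shape.  They are
-- needed because complexityF and atomicF only compute on such shapes.
atom∈atom-measures : ∀ {Γ k l} {a : Term Γ k} {b : Term Γ l} {p} → IsAtom a → IsAtom b →
                     (complexityF (mem a b p) ≡ 3) × (atomicF (mem a b p) ≡ 0)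
atom∈atom-measures (free n)  (free m)  = refl , refl
atom∈atom-measures (free n)  (bound y) = refl , refl
atom∈atom-measures (bound x) (free m)  = refl , refl
atom∈atom-measures (bound x) (bound y) = refl , refl

atom∈comp-measures : ∀ {Γ j k} {a : Term Γ j} {φ : Form (k ∷ Γ)} {p} → IsAtom a →
                     (complexityF (mem a (comp k φ) p) ≡ complexityF φ) ×
                     (atomicF (mem a (comp k φ) p) ≡ atomicF φ + 1)
atom∈comp-measures (free n)  = refl , refl
atom∈comp-measures (bound x) = refl , refl

∈atom-atomic : ∀ {Γ k l} {s : Term Γ k} {b : Term Γ l} {p} → IsAtom b →
               atomicF (mem s b p) ≡ atomicT s
∈atom-atomic (free n)  = refl
∈atom-atomic (bound x) = refl

complexity≥3 : ∀ {Γ} (φ : Form Γ) → 3 ≤ complexityF φ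
complexity≥3 ⊥' = ≤-refl
complexity≥3 (¬' φ) = m≤n⇒m≤1+n (complexity≥3 φ)
complexity≥3 (φ ∧' ψ) = ≤-trans (complexity≥3 φ) (≤-trans (m≤m+n _ 1) (m≤m+n _ _))
complexity≥3 (∀' k φ) = m≤n⇒m≤1+n (complexity≥3 φ)
complexity≥3 (mem (atom n) (atom m) p) = ≤-refl
complexity≥3 (mem (atom n) (var y) p) = ≤-refl
complexity≥3 (mem (atom n) (comp k φ) p) = complexity≥3 φ
complexity≥3 (mem (var x) (atom m) p) = ≤-refl
complexity≥3 (mem (var x) (var y) p) = ≤-refl
complexity≥3 (mem (var x) (comp k φ) p) = complexity≥3 φ
complexity≥3 (mem (comp j ψ) s p) =
  ≤-trans (m≤n⇒m≤1+n (complexity≥3 ψ)) (≤-trans (m≤m+n _ 1) (m≤m+n _ _))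

-- A ternary formula in which some atom occurs at least three times has
-- complexity at least 7; this bounds the body of a ternary comprehension.
ternary-complexity≥7 : ∀ {Γ} (φ : Form Γ) i → TernaryF φ → 3 ≤ occF i φ → 7 ≤ complexityF φ
ternary-complexity≥7 ⊥' i T ()
ternary-complexity≥7 (¬' φ) i T o = m≤n⇒m≤1+n (ternary-complexity≥7 φ i T o)
ternary-complexity≥7 (φ ∧' ψ) i T o =
  +-mono-≤ (+-mono-≤ (complexity≥3 φ) (≤-refl {1})) (complexity≥3 ψ)
ternary-complexity≥7 (∀' k φ) i T o = m≤n⇒m≤1+n (ternary-complexity≥7 φ (suc i) T o)
ternary-complexity≥7 (mem (atom n) (atom m) p) i T ()
ternary-complexity≥7 (mem (atom n) (var y) p) i T o =
  ⊥-elim (<⇒≱ o (m≤n⇒m≤1+n (occ-atom≤1 i (bound y))))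
ternary-complexity≥7 (mem (var x) (atom m) p) i T o =
  ⊥-elim (<⇒≱ o (+-mono-≤ (occ-atom≤1 i (bound x)) z≤n))
ternary-complexity≥7 (mem (var x) (var y) p) i T o =
  ⊥-elim (<⇒≱ o (+-mono-≤ (occ-atom≤1 i (bound x)) (occ-atom≤1 i (bound y))))
ternary-complexity≥7 (mem (atom n) (comp k φ) p) i (_ , (o3 , T)) o = ternary-complexity≥7 φ 0 T o3
ternary-complexity≥7 (mem (var x) (comp k φ) p) i (_ , (o3 , T)) o = ternary-complexity≥7 φ 0 T o3
ternary-complexity≥7 (mem (comp j ψ) s p) i ((o3 , T) , _) o =
  ≤-trans (m≤n⇒m≤1+n (ternary-complexity≥7 ψ 0 T o3)) (≤-trans (m≤m+n _ 1) (m≤m+n _ _))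

mutual
  renT-complexity : ∀ {Γ Δ l} (ρ : Ren Γ Δ) (t : Term Γ l) →
                    complexityT (renT ρ t) ≡ complexityT t
  renT-complexity ρ (atom n) = refl
  renT-complexity ρ (var x) = refl
  renT-complexity ρ (comp k φ) = cong suc (renF-complexity (extR ρ) φ)

  renF-complexity : ∀ {Γ Δ} (ρ : Ren Γ Δ) (φ : Form Γ) →
                    complexityF (renF ρ φ) ≡ complexityF φ
  renF-complexity ρ ⊥' = refl
  renF-complexity ρ (¬' φ) = cong suc (renF-complexity ρ φ)
  renF-complexity ρ (φ ∧' ψ) =
    cong₂ (λ a b → a + 1 + b) (renF-complexity ρ φ) (renF-complexity ρ ψ)
  renF-complexity ρ (∀' k φ) = cong suc (renF-complexity (extR ρ) φ)
  renF-complexity ρ (mem (atom n) (atom m) p) = refl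
  renF-complexity ρ (mem (atom n) (var y) p) = refl
  renF-complexity ρ (mem (atom n) (comp k φ) p) = renF-complexity (extR ρ) φ
  renF-complexity ρ (mem (var x) (atom m) p) = refl
  renF-complexity ρ (mem (var x) (var y) p) = refl
  renF-complexity ρ (mem (var x) (comp k φ) p) = renF-complexity (extR ρ) φ
  renF-complexity ρ (mem (comp j ψ) s p) =
    cong₂ (λ a b → suc a + 1 + b) (renF-complexity (extR ρ) ψ) (renT-complexity ρ s)

AtomicSub : ∀ {Γ Δ} → Sub Γ Δ → Set
AtomicSub σ = ∀ {l} x → IsAtom (σ {l} x)

extS-atomic : ∀ {Γ Δ k} {σ : Sub Γ Δ} → AtomicSub σ → AtomicSub (extS {k = k} σ)
extS-atomic A ze = bound ze
extS-atomic {σ = σ} A (su x) with σ x | A x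
... | atom n | free .n  = free n
... | var y  | bound .y = bound (su y)

-- Atomic substitutions preserve both complexity and atomic reducts: they
-- never change the shape of a membership.
mutual
  subT-atomic : ∀ {Γ Δ l} (σ : Sub Γ Δ) → AtomicSub σ → (t : Term Γ l) →
                (complexityT (subT σ t) ≡ complexityT t) × (atomicT (subT σ t) ≡ atomicT t)
  subT-atomic σ A (atom n) = refl , refl
  subT-atomic σ A (var x) with σ x | A x
  ... | atom n | free .n  = refl , refl
  ... | var y  | bound .y = refl , refl
  subT-atomic σ A (comp k φ) =
    let (c≡ , a≡) = subF-atomic (extS σ) (extS-atomic A) φ in cong suc c≡ , a≡

  subF-atomic : ∀ {Γ Δ} (σ : Sub Γ Δ) → AtomicSub σ → (φ : Form Γ) →
                (complexityF (subF σ φ) ≡ complexityF φ) × (atomicF (subF σ φ) ≡ atomicF φ)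
  subF-atomic σ A ⊥' = refl , refl
  subF-atomic σ A (¬' φ) = let (c≡ , a≡) = subF-atomic σ A φ in cong suc c≡ , a≡
  subF-atomic σ A (φ ∧' ψ) =
    let (c≡ , a≡) = subF-atomic σ A φ ; (c≡' , a≡') = subF-atomic σ A ψ in
    cong₂ (λ a b → a + 1 + b) c≡ c≡' , cong₂ _+_ a≡ a≡'
  subF-atomic σ A (∀' k φ) =
    let (c≡ , a≡) = subF-atomic (extS σ) (extS-atomic A) φ in cong suc c≡ , a≡
  subF-atomic {Δ = Δ} σ A (mem {k} {l} (atom n) (atom m) p) =
    atom∈atom-measures {Γ = Δ} {p = p} (free {l = k} n) (free {l = l} m)
  subF-atomic σ A (mem (atom n) (var y) p) = atom∈atom-measures {p = p} (free n) (A y)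
  subF-atomic σ A (mem (var x) (atom m) p) = atom∈atom-measures {p = p} (A x) (free m)
  subF-atomic σ A (mem (var x) (var y) p) = atom∈atom-measures {p = p} (A x) (A y)
  subF-atomic σ A (mem (atom n) (comp k φ) p) =
    let (c≡ , a≡) = subF-atomic (extS σ) (extS-atomic A) φ in c≡ , cong (_+ 1) a≡
  subF-atomic σ A (mem (var x) (comp k φ) p) =
    let (c-shape , a-shape) = atom∈comp-measures {φ = subF (extS σ) φ} {p = p} (A x)
        (c≡ , a≡) = subF-atomic (extS σ) (extS-atomic A) φ in
    trans c-shape c≡ , trans a-shape (cong (_+ 1) a≡)
  subF-atomic σ A (mem (comp j ψ) (atom m) p) =
    let (c≡ , a≡) = subF-atomic (extS σ) (extS-atomic A) ψ in
    cong (λ c → suc c + 1 + 1) c≡ , a≡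
  subF-atomic σ A (mem (comp j ψ) (var y) p) =
    let (c≡ , a≡) = subF-atomic (extS σ) (extS-atomic A) ψ in
    cong₂ (λ c c' → suc c + 1 + c') c≡ (proj₁ (subT-atomic σ A (var y))) ,
    trans (∈atom-atomic {s = subT σ (comp j ψ)} {p = p} (A y)) a≡
  subF-atomic σ A (mem (comp j ψ) (comp k φ) p) =
    let (c≡ , a≡) = subF-atomic (extS σ) (extS-atomic A) ψ
        (c≡' , a≡') = subF-atomic (extS σ) (extS-atomic A) φ in
    cong₂ (λ c c' → suc c + 1 + suc c') c≡ c≡' , cong₂ _+_ a≡ a≡'

-- Weight D o t: t is an atom (weight o = 0) or a comprehension whose body
-- has complexity at least D + 3 (weight o = 1).  A term of weight o put in
-- place of a bound atom raises complexity by at least o * D.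
data Weight (D : ℕ) {Γ} : ∀ {l} → ℕ → Term Γ l → Set where
  atomic : ∀ {l} {t : Term Γ l} → IsAtom t → Weight D 0 t
  heavy  : ∀ k φ → D + 3 ≤ complexityF φ → Weight D 1 (comp k φ)

HeavyAt : ∀ {Γ Δ} → ℕ → ℕ → Sub Γ Δ → Set
HeavyAt i D σ = ∀ {l} x → Weight D (eqℕ i (idx x)) (σ {l} x)

renT-weight : ∀ {Γ Δ l D o} (ρ : Ren Γ Δ) {t : Term Γ l} → Weight D o t → Weight D o (renT ρ t)
renT-weight ρ (atomic (free n))  = atomic (free n)
renT-weight ρ (atomic (bound x)) = atomic (bound (ρ x))
renT-weight ρ (heavy k φ h) =
  heavy k (renF (extR ρ) φ) (subst (_ ≤_) (sym (renF-complexity (extR ρ) φ)) h)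

extS-heavy : ∀ {Γ Δ k i D} {σ : Sub Γ Δ} → HeavyAt i D σ → HeavyAt (suc i) D (extS {k = k} σ)
extS-heavy H ze = atomic (bound ze)
extS-heavy H (su x) = renT-weight su (H x)

weight-complexity : ∀ {Γ l D o} {t : Term Γ l} → Weight D o t → 1 + o * D ≤ complexityT t
weight-complexity (atomic (free n))  = ≤-refl
weight-complexity (atomic (bound x)) = ≤-refl
weight-complexity {D = D} (heavy k φ h) =
  s≤s (≤-trans (≤-reflexive (+-identityʳ D)) (≤-trans (m≤m+n D 3) h))

-- The margin 3 in the definition of Weight is needed exactly when
-- the right side turns heavy: a ∈ b of complexity 3 becomes a ∈ {x | φ} of
-- complexity c(φ).
weight-mem : ∀ {Γ k l D o o'} {a : Term Γ k} {b : Term Γ l} {p} →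
             Weight D o a → Weight D o' b → 3 + (o + o') * D ≤ complexityF (mem a b p)
weight-mem (atomic A) (atomic B) = ≤-reflexive (sym (proj₁ (atom∈atom-measures A B)))
weight-mem {D = D} (atomic A) (heavy k φ h) =
  ≤-trans (≤-reflexive (heavy-margin D))
    (≤-trans h (≤-reflexive (sym (proj₁ (atom∈comp-measures A)))))
  where
  heavy-margin : ∀ D → 3 + (0 + 1) * D ≡ D + 3
  heavy-margin = solve-∀
weight-mem {D = D} {o' = o'} (heavy j ψ h) w =
  ≤-trans (≤-reflexive (rearrange D o'))
    (+-mono-≤ (+-mono-≤ (s≤s (≤-trans (m≤m+n D 3) h)) (≤-refl {1})) (weight-complexity w))
  where
  rearrange : ∀ D o' → 3 + (1 + o') * D ≡ (1 + D) + 1 + (1 + o' * D)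
  rearrange = solve-∀

weight∈comp : ∀ {Γ j k D o o'} {a : Term Γ j} {φ : Form (k ∷ Γ)} {p} (c : ℕ) →
              Weight D o a → c + o' * D ≤ complexityF φ →
              c + (o + o') * D ≤ complexityF (mem a (comp k φ) p)
weight∈comp c (atomic A) h = ≤-trans h (≤-reflexive (sym (proj₁ (atom∈comp-measures A))))
weight∈comp {D = D} {o' = o'} {φ = φ} c (heavy j ψ h') h =
  ≤-trans (≤-reflexive (split c o' D))
    (≤-trans (+-mono-≤ (≤-trans (m≤m+n D 3) h') h)
      (≤-trans (m≤n+m _ 3) (≤-reflexive (sym (regroup (complexityF ψ) (complexityF φ))))))
  where
  split : ∀ c o' D → c + (1 + o') * D ≡ D + (c + o' * D)
  split = solve-∀
  regroup : ∀ a b → suc a + 1 + suc b ≡ 3 + (a + b)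
  regroup = solve-∀

mutual
  subT-heavy : ∀ {Γ Δ l} i D (σ : Sub Γ Δ) → HeavyAt i D σ → (t : Term Γ l) →
               complexityT t + occT i t * D ≤ complexityT (subT σ t)
  subT-heavy i D σ H (atom n) = ≤-refl
  subT-heavy i D σ H (var x) = weight-complexity (H x)
  subT-heavy i D σ H (comp k φ) = s≤s (subF-heavy (suc i) D (extS σ) (extS-heavy H) φ)

  subF-heavy : ∀ {Γ Δ} i D (σ : Sub Γ Δ) → HeavyAt i D σ → (φ : Form Γ) →
               complexityF φ + occF i φ * D ≤ complexityF (subF σ φ)
  subF-heavy i D σ H ⊥' = ≤-refl
  subF-heavy i D σ H (¬' φ) = s≤s (subF-heavy i D σ H φ)
  subF-heavy i D σ H (φ ∧' ψ) =
    ≤-trans (≤-reflexive (∧-split (complexityF φ) (complexityF ψ) (occF i φ) (occF i ψ) D))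
      (+-mono-≤ (+-mono-≤ (subF-heavy i D σ H φ) (≤-refl {1})) (subF-heavy i D σ H ψ))
    where
    ∧-split : ∀ c c' o o' D → (c + 1 + c') + (o + o') * D ≡ (c + o * D) + 1 + (c' + o' * D)
    ∧-split = solve-∀
  subF-heavy i D σ H (∀' k φ) = s≤s (subF-heavy (suc i) D (extS σ) (extS-heavy H) φ)
  subF-heavy {Δ = Δ} i D σ H (mem {k} {l} (atom n) (atom m) p) =
    weight-mem {Γ = Δ} {D = D} {p = p} (atomic (free {l = k} n)) (atomic (free {l = l} m))
  subF-heavy i D σ H (mem (atom n) (var y) p) = weight-mem {D = D} (atomic (free n)) (H y)
  subF-heavy i D σ H (mem (var x) (atom m) p) = weight-mem {D = D} (H x) (atomic (free m))
  subF-heavy i D σ H (mem (var x) (var y) p) = weight-mem {D = D} (H x) (H y)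
  subF-heavy i D σ H (mem {j} (atom n) (comp k φ) p) =
    weight∈comp {D = D} {o' = occF (suc i) φ} {φ = subF (extS σ) φ} {p = p}
      (complexityF φ) (atomic (free {l = j} n)) (subF-heavy (suc i) D (extS σ) (extS-heavy H) φ)
  subF-heavy i D σ H (mem (var x) (comp k φ) p) =
    weight∈comp {D = D} {o' = occF (suc i) φ} {φ = subF (extS σ) φ}
      (complexityF φ) (H x) (subF-heavy (suc i) D (extS σ) (extS-heavy H) φ)
  subF-heavy i D σ H (mem (comp j ψ) s p) =
    ≤-trans (≤-reflexive (comp∈-split (complexityF ψ) (complexityT s) (occF (suc i) ψ) (occT i s) D))
      (+-mono-≤ (+-mono-≤ (s≤s (subF-heavy (suc i) D (extS σ) (extS-heavy H) ψ)) (≤-refl {1}))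
                (subT-heavy i D σ H s))
    where
    comp∈-split : ∀ c c' o o' D → suc c + 1 + c' + (o + o') * D ≡ suc (c + o * D) + 1 + (c' + o' * D)
    comp∈-split = solve-∀

single-atomic : ∀ {Γ k} {t : Term Γ k} → IsAtom t → AtomicSub (single t)
single-atomic A ze = A
single-atomic A (su x) = bound x

-- β-step with an atomic argument: complexity is unchanged, and the redex,
-- which was itself an atomic reduct, disappears.
β-atom : ∀ {Γ k} {t : Term Γ k} (φ : Form (k ∷ Γ)) → IsAtom t →
         Progress (complexityF (mem t (comp k φ) refl)) (atomicF (mem t (comp k φ) refl))
                  (complexityF (φ [ t ])) (atomicF (φ [ t ]))
β-atom φ A =
  let (c-redex , a-redex) = atom∈comp-measures {φ = φ} {p = refl} A
      (c-result , a-result) = subF-atomic (single _) (single-atomic A) φ in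
  inj₂ ( trans c-result (sym c-redex)
       , subst₂ _>_ (sym a-redex) (sym a-result) (m<m+n (atomicF φ) (s≤s z≤n)) )

-- Arithmetic of the comprehension β-case, for a body of complexity 7 + e:
-- at least three occurrences each worth 4 + e beat the redex's complexity.
redex<substituted : ∀ e c o → 3 ≤ o → suc (7 + e) + 1 + suc c < c + o * (4 + e)
redex<substituted e c o o≥3 = begin-strict
  suc (7 + e) + 1 + suc c  ≡⟨ regroup e c ⟩
  c + (10 + e)             <⟨ +-monoʳ-< c (≤-trans (m≤m+n (11 + e) (1 + (e + e))) (≤-reflexive (triple e))) ⟩
  c + 3 * (4 + e)          ≤⟨ +-monoʳ-≤ c (*-monoˡ-≤ (4 + e) o≥3) ⟩
  c + o * (4 + e)          ∎
  where
  open ≤-Reasoning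
  regroup : ∀ e c → suc (7 + e) + 1 + suc c ≡ c + (10 + e)
  regroup = solve-∀
  triple : ∀ e → 11 + e + (1 + (e + e)) ≡ 3 * (4 + e)
  triple = solve-∀

β-comp : ∀ {Γ j} (ψ : Form (j ∷ Γ)) (φ : Form (sucℤ j ∷ Γ)) → TernaryT (comp j ψ) →
         3 ≤ occF 0 φ →
         complexityF (mem (comp j ψ) (comp (sucℤ j) φ) refl) < complexityF (φ [ comp j ψ ])
β-comp {j = j} ψ φ (o3ψ , Tψ) o3φ with m≤n⇒∃[o]m+o≡n (ternary-complexity≥7 ψ 0 Tψ o3ψ)
... | e , 7+e≡cψ = begin-strict
  suc (complexityF ψ) + 1 + suc (complexityF φ)
    ≡⟨ cong (λ c → suc c + 1 + suc (complexityF φ)) (sym 7+e≡cψ) ⟩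
  suc (7 + e) + 1 + suc (complexityF φ)
    <⟨ redex<substituted e (complexityF φ) (occF 0 φ) o3φ ⟩
  complexityF φ + occF 0 φ * (4 + e)
    ≤⟨ subF-heavy 0 (4 + e) (single (comp j ψ)) heavy-at-0 φ ⟩
  complexityF (φ [ comp j ψ ])
    ∎
  where
  open ≤-Reasoning
  heavy-at-0 : HeavyAt 0 (4 + e) (single (comp j ψ))
  heavy-at-0 ze = heavy j ψ (≤-reflexive (trans (+-comm (4 + e) 3) 7+e≡cψ))
  heavy-at-0 (su x) = atomic (bound x)

mutual
  stepF-progress : ∀ {Γ} {φ φ' : Form Γ} → TernaryF φ → φ ⟶F φ' →
                   Progress (complexityF φ) (atomicF φ) (complexityF φ') (atomicF φ')
  stepF-progress T (β (atom n) φ) = β-atom φ (free n)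
  stepF-progress T (β (var x) φ) = β-atom φ (bound x)
  stepF-progress (Tψ , (o3φ , _)) (β (comp j ψ) φ) = inj₁ (β-comp ψ φ Tψ o3φ)
  stepF-progress T (ξ¬ r) = progress-suc (stepF-progress T r)
  stepF-progress T (ξ∀ r) = progress-suc (stepF-progress T r)
  stepF-progress {φ = φ ∧' ψ} (T , _) (ξ∧ˡ r) =
    progress-map (λ c → c + 1 + complexityF ψ) (_+ atomicF ψ)
      (λ h → +-monoˡ-< (complexityF ψ) (+-monoˡ-< 1 h)) (+-monoˡ-< (atomicF ψ))
      (stepF-progress T r)
  stepF-progress {φ = φ ∧' ψ} (_ , T) (ξ∧ʳ r) =
    progress-map (complexityF φ + 1 +_) (atomicF φ +_)
      (+-monoʳ-< (complexityF φ + 1)) (+-monoʳ-< (atomicF φ))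
      (stepF-progress T r)
  -- The measures of s ∈ t depend on the shapes of s and t, hence the case
  -- split; a reducible side is always a comprehension.
  stepF-progress {φ = mem (comp j ψ) (atom m) p} (T , _) (ξ∈ˡ r@(ξcomp _)) =
    progress-map (λ c → c + 1 + 1) (λ a → a)
      (λ h → +-monoˡ-< 1 (+-monoˡ-< 1 h)) (λ h → h) (stepT-progress T r)
  stepF-progress {φ = mem (comp j ψ) (var y) p} (T , _) (ξ∈ˡ r@(ξcomp _)) =
    progress-map (λ c → c + 1 + 1) (λ a → a)
      (λ h → +-monoˡ-< 1 (+-monoˡ-< 1 h)) (λ h → h) (stepT-progress T r)
  stepF-progress {φ = mem (comp j ψ) (comp k χ) p} (T , _) (ξ∈ˡ r@(ξcomp _)) =
    progress-map (λ c → c + 1 + suc (complexityF χ)) (_+ atomicF χ)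
      (λ h → +-monoˡ-< (suc (complexityF χ)) (+-monoˡ-< 1 h)) (+-monoˡ-< (atomicF χ))
      (stepT-progress T r)
  stepF-progress {φ = mem (atom n) (comp k χ) p} (_ , (_ , T)) (ξ∈ʳ (ξcomp r)) =
    progress-map (λ c → c) (_+ 1) (λ h → h) (+-monoˡ-< 1) (stepF-progress T r)
  stepF-progress {φ = mem (var x) (comp k χ) p} (_ , (_ , T)) (ξ∈ʳ (ξcomp r)) =
    progress-map (λ c → c) (_+ 1) (λ h → h) (+-monoˡ-< 1) (stepF-progress T r)
  stepF-progress {φ = mem (comp j ψ) (comp k χ) p} (_ , T) (ξ∈ʳ r@(ξcomp _)) =
    progress-map (suc (complexityF ψ) + 1 +_) (atomicF ψ +_)
      (+-monoʳ-< (suc (complexityF ψ) + 1)) (+-monoʳ-< (atomicF ψ))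
      (stepT-progress T r)

  stepT-progress : ∀ {Γ l} {t t' : Term Γ l} → TernaryT t → t ⟶T t' →
                   Progress (complexityT t) (atomicT t) (complexityT t') (atomicT t')
  stepT-progress (_ , T) (ξcomp r) = progress-suc (stepF-progress T r)

corollary5p27 :
    ((φ φ' : Form []) → TernaryF φ → φ ⟶F φ' →
      ExactlyOne (complexityF φ < complexityF φ')
                 ((complexityF φ' ≡ complexityF φ) × (atomicF φ > atomicF φ')))
    ×
    ((l : ℤ) (t t' : Term [] l) → TernaryT t → t ⟶T t' →
      ExactlyOne (complexityT t < complexityT t')
                 ((complexityT t' ≡ complexityT t) × (atomicT t > atomicT t')))
corollary5p27 =
    (λ φ φ' T r → progress⇒exactlyOne (stepF-progress T r))
  , (λ l t t' T r → progress⇒exactlyOne (stepT-progress T r))
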